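{- Linear-changing identity substitutions are injective: given terms $M$, $M'$ and a linear-changing identity substitution $s$, if $M[s]=M'[s]$ then $M=M'$.
   Context: Calculus (λ-calculus with linear, affine and intuitionistic variables, in canonical form). Types: $A,B ::= a \mid A\,\&\,B \mid A\multimap B \mid A\rightarrowtail B \mid A\to B$. Variables are de Bruijn indices $n\ge1$ with a flag $f\in\{\mathsf I,\mathsf A,\mathsf L\}$ (intuitionistic, affine, linear), written $n^f$. Logic variables $X$ have a fixed context and type. Substitutions $s::=\mathsf{id}\mid{\uparrow}\mid M^f.s\mid s\circ t$, ${\uparrow}^n$ the $n$-fold composition of ${\uparrow}$. Canonical terms: $R::= n^f\mid X[s]\mid \mathsf{fst}\,R\mid\mathsf{snd}\,R\mid R\,\hat{}\,M\mid R\,@\,M\mid R\,M$, $M::=R\mid\langle M,N\rangle\mid\hat\lambda M\mid\lambda^{\mathsf A}M\mid\lambda M$ (linear, affine, intuitionistic application/abstraction). $M[s]$ denotes the canonical form of applying $s$ to $M$ (hereditary substitution) with the equations $1^f[M^f.s]=M$, $(n+1)^f=1^f[{\uparrow}^n]$, $M[s][t]=M[s\circ t]$, $X[s][t]=X[s\circ t]$, ${\uparrow}\circ(M^f.s)=s$, $(M^f.s)\circ t=M[t]^f.(s\circ t)$, ${\uparrow}^n=(n+1)^{ff}.{\uparrow}^{n+1}$, substitution commuting with pairs, projections and applications, and going under binders as $(\hat\lambda M)[s]=\hat\lambda(M[1^{\mathsf{LL}}.(s\circ{\uparrow})])$ (resp. $1^{\mathsf{AA}}$ for $\lambda^{\mathsf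 A}$, $1^{\mathsf{II}}$ for $\lambda$). An extension $M^f$ in a substitution whose term is a variable $m^{f'}$ is written $m^{f'f}$; such an extension is linear-changing if $f'f\in\{\mathsf{IL},\mathsf{IA},\mathsf{AL}\}$. A linear-changing identity substitution is a substitution of the form $1^{f_1f'_1}.2^{f_2f'_2}\ldots n^{f_nf'_n}.{\uparrow}^n$ with each $f_jf'_j\in\{\mathsf{II},\mathsf{AA},\mathsf{LL},\mathsf{IL},\mathsf{IA},\mathsf{AL}\}$, i.e. η-equivalent to $\mathsf{id}$ except for some number of linear-changing extensions. -}

module Defs where

open import Data.Nat using (ℕ; zero; suc; _+_)

-- Flags: intuitionistic, affine, linear
data Flag : Set where
  I A L : Flag

-- Convention: de Bruijn index n ≥ 1 of the paper is represented by
-- (var k f) with k = n - 1, i.e. (var k f) stands for (k+1)^f.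
-- Substitutions are kept in σ-normal form  M₁^f₁ . … . Mₖ^fₖ . ↑ⁿ
-- (id = ↑⁰); composition is computed by the relation _∘_⇓_ below.

mutual
  data Atm : Set where
    var  : ℕ → Flag → Atm
    mvar : ℕ → Sub → Atm
    fst  : Atm → Atm
    snd  : Atm → Atm
    lapp : Atm → Can → Atm
    aapp : Atm → Can → Atm
    iapp : Atm → Can → Atm

  data Can : Set where
    atm  : Atm → Can
    pair : Can → Can → Can
    llam : Can → Can
    alam : Can → Can
    ilam : Can → Can

  data Sub : Set where
    shift : ℕ → Sub
    ext   : Can → Flag → Sub → Sub

idS : Sub
idS = shift 0

mutual
  data _⟨_⟩ᵛ⇓_ : Atm → Sub → Can → Set where
    v-here  : ∀ {f M s} → var zero f ⟨ ext M f s ⟩ᵛ⇓ M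
    v-there : ∀ {k f M g s N} → var k f ⟨ s ⟩ᵛ⇓ N →
              var (suc k) f ⟨ ext M g s ⟩ᵛ⇓ N
    v-shift : ∀ {k f n} → var k f ⟨ shift n ⟩ᵛ⇓ atm (var (k + n) f)

  data _[_]ᴿ⇓_ : Atm → Sub → Can → Set where
    s-var   : ∀ {k f s N} → var k f ⟨ s ⟩ᵛ⇓ N → var k f [ s ]ᴿ⇓ N
    s-mvar  : ∀ {X t s u} → t ∘ s ⇓ u → mvar X t [ s ]ᴿ⇓ atm (mvar X u)
    s-fst   : ∀ {R s R'} → R [ s ]ᴿ⇓ atm R' → fst R [ s ]ᴿ⇓ atm (fst R')
    s-fstβ  : ∀ {R s M N} → R [ s ]ᴿ⇓ pair M N → fst R [ s ]ᴿ⇓ M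
    s-snd   : ∀ {R s R'} → R [ s ]ᴿ⇓ atm R' → snd R [ s ]ᴿ⇓ atm (snd R')
    s-sndβ  : ∀ {R s M N} → R [ s ]ᴿ⇓ pair M N → snd R [ s ]ᴿ⇓ N
    s-lapp  : ∀ {R M s R' M'} → R [ s ]ᴿ⇓ atm R' → M [ s ]⇓ M' →
              lapp R M [ s ]ᴿ⇓ atm (lapp R' M')
    s-lappβ : ∀ {R M s B M' P} → R [ s ]ᴿ⇓ llam B → M [ s ]⇓ M' →
              B [ ext M' L idS ]⇓ P → lapp R M [ s ]ᴿ⇓ P
    s-aapp  : ∀ {R M s R' M'} → R [ s ]ᴿ⇓ atm R' → M [ s ]⇓ M' →
              aapp R M [ s ]ᴿ⇓ atm (aapp R' M')
    s-aappβ : ∀ {R M s B M' P} → R [ s ]ᴿ⇓ alam B → M [ s ]⇓ M' →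
              B [ ext M' A idS ]⇓ P → aapp R M [ s ]ᴿ⇓ P
    s-iapp  : ∀ {R M s R' M'} → R [ s ]ᴿ⇓ atm R' → M [ s ]⇓ M' →
              iapp R M [ s ]ᴿ⇓ atm (iapp R' M')
    s-iappβ : ∀ {R M s B M' P} → R [ s ]ᴿ⇓ ilam B → M [ s ]⇓ M' →
              B [ ext M' I idS ]⇓ P → iapp R M [ s ]ᴿ⇓ P

  data _[_]⇓_ : Can → Sub → Can → Set where
    s-atm  : ∀ {R s N} → R [ s ]ᴿ⇓ N → atm R [ s ]⇓ N
    s-pair : ∀ {M N s M' N'} → M [ s ]⇓ M' → N [ s ]⇓ N' →
             pair M N [ s ]⇓ pair M' N'
    s-llam : ∀ {M s u M'} → s ∘ shift 1 ⇓ u →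
             M [ ext (atm (var zero L)) L u ]⇓ M' → llam M [ s ]⇓ llam M'
    s-alam : ∀ {M s u M'} → s ∘ shift 1 ⇓ u →
             M [ ext (atm (var zero A)) A u ]⇓ M' → alam M [ s ]⇓ alam M'
    s-ilam : ∀ {M s u M'} → s ∘ shift 1 ⇓ u →
             M [ ext (atm (var zero I)) I u ]⇓ M' → ilam M [ s ]⇓ ilam M'

  data _∘_⇓_ : Sub → Sub → Sub → Set where
    c-ext     : ∀ {M f s t M' u} → M [ t ]⇓ M' → s ∘ t ⇓ u →
                ext M f s ∘ t ⇓ ext M' f u
    c-id      : ∀ {t} → shift zero ∘ t ⇓ t
    c-shext   : ∀ {m M f t u} → shift m ∘ t ⇓ u →
                shift (suc m) ∘ ext M f t ⇓ u
    c-shsh    : ∀ {m n} → shift (suc m) ∘ shift n ⇓ shift (suc m + n)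

mutual
  data _≈ᴿ_ : Atm → Atm → Set where
    reflᴿ  : ∀ {R} → R ≈ᴿ R
    symᴿ   : ∀ {R R'} → R ≈ᴿ R' → R' ≈ᴿ R
    transᴿ : ∀ {R R' R''} → R ≈ᴿ R' → R' ≈ᴿ R'' → R ≈ᴿ R''
    mvar≈  : ∀ {X s s'} → s ≈ˢ s' → mvar X s ≈ᴿ mvar X s'
    fst≈   : ∀ {R R'} → R ≈ᴿ R' → fst R ≈ᴿ fst R'
    snd≈   : ∀ {R R'} → R ≈ᴿ R' → snd R ≈ᴿ snd R'
    lapp≈  : ∀ {R R' M M'} → R ≈ᴿ R' → M ≈ M' → lapp R M ≈ᴿ lapp R' M'
    aapp≈  : ∀ {R R' M M'} → R ≈ᴿ R' → M ≈ M' → aapp R M ≈ᴿ aapp R' M'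
    iapp≈  : ∀ {R R' M M'} → R ≈ᴿ R' → M ≈ M' → iapp R M ≈ᴿ iapp R' M'

  data _≈_ : Can → Can → Set where
    refl≈  : ∀ {M} → M ≈ M
    sym≈   : ∀ {M M'} → M ≈ M' → M' ≈ M
    trans≈ : ∀ {M M' M''} → M ≈ M' → M' ≈ M'' → M ≈ M''
    atm≈   : ∀ {R R'} → R ≈ᴿ R' → atm R ≈ atm R'
    pair≈  : ∀ {M M' N N'} → M ≈ M' → N ≈ N' → pair M N ≈ pair M' N'
    llam≈  : ∀ {M M'} → M ≈ M' → llam M ≈ llam M'
    alam≈  : ∀ {M M'} → M ≈ M' → alam M ≈ alam M'
    ilam≈  : ∀ {M M'} → M ≈ M' → ilam M ≈ ilam M'

  data _≈ˢ_ : Sub → Sub → Set where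
    reflˢ  : ∀ {s} → s ≈ˢ s
    symˢ   : ∀ {s s'} → s ≈ˢ s' → s' ≈ˢ s
    transˢ : ∀ {s s' s''} → s ≈ˢ s' → s' ≈ˢ s'' → s ≈ˢ s''
    ext≈   : ∀ {M M' f s s'} → M ≈ M' → s ≈ˢ s' → ext M f s ≈ˢ ext M' f s'
    η-shift : ∀ {n f} → shift n ≈ˢ ext (atm (var n f)) f (shift (suc n))

-- Linear-changing identity substitutions
--   1^{f₁f'₁} . 2^{f₂f'₂} … n^{fₙf'ₙ} . ↑ⁿ
-- where  m^{f f'}  is the extension (m^f)^{f'}  and each pair f f'
-- is one of II, AA, LL, IL, IA, AL.

data Allowed : Flag → Flag → Set where
  II : Allowed I I
  AA : Allowed A A
  LL : Allowed L L
  IL : Allowed I L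
  IA : Allowed I A
  AL : Allowed A L

data LCFrom : ℕ → Sub → Set where
  lc-done : ∀ {k} → LCFrom k (shift k)
  lc-step : ∀ {k f f' s} → Allowed f f' → LCFrom (suc k) s →
            LCFrom k (ext (atm (var k f)) f' s)

LinChangingId : Sub → Set
LinChangingId s = LCFrom zero s

-- A linear-changing identity s = lcId P 0 only changes the flags of variables, so M[s] contains
-- no new redexes and the change is undone syntactically: invᶜ P swaps every flag pair of s back,
-- and invᶜ P (M[s]) ≈ M. But invᶜ P respects the η-law ↑ᵏ = (k+1)^{gg}.↑ᵏ⁺¹ only when g is the flag
-- that s puts on k+1, and ≈-related terms need not both have this property. So invᶜ P is applied
-- to η-contracted forms: nfᶜ identifies ≈-related terms and invᶜ P (nfᶜ N) ≈ invᶜ P N on images N,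
-- whence M ≈ invᶜ P (nfᶜ N) = invᶜ P (nfᶜ N') ≈ M'.
module Submission where

open import Defs
open import Data.Nat using (ℕ; zero; suc; _+_)
open import Data.Nat.Properties using (_≟_; +-suc; +-comm; +-identityʳ)
open import Data.List using (List; []; _∷_; drop; head; map)
open import Data.Maybe using (Maybe; just; nothing)
open import Data.Product using (∃; _×_; _,_; proj₂; swap; map₂; zip′)
open import Data.Unit using (⊤; tt)
open import Relation.Nullary using (yes; no; contradiction)
open import Relation.Nullary.Decidable using (_×-dec_)
open import Relation.Binary.Bundles using (Setoid)
open import Relation.Binary.Definitions using (DecidableEquality)
import Relation.Binary.Reasoning.Setoid as SetoidReasoning
open import Relation.Binary.PropositionalEquality
  using (_≡_; refl; sym; trans; cong; cong₂; subst)

_≟ᶠ_ : DecidableEquality Flag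
I ≟ᶠ I = yes refl
I ≟ᶠ A = no λ ()
I ≟ᶠ L = no λ ()
A ≟ᶠ I = no λ ()
A ≟ᶠ A = yes refl
A ≟ᶠ L = no λ ()
L ≟ᶠ I = no λ ()
L ≟ᶠ A = no λ ()
L ≟ᶠ L = yes refl

≈ᴿ-reflexive : ∀ {R R'} → R ≡ R' → R ≈ᴿ R'
≈ᴿ-reflexive refl = reflᴿ

≈-setoid : Setoid _ _
≈-setoid = record
  { Carrier = Can
  ; _≈_ = _≈_
  ; isEquivalence = record { refl = refl≈ ; sym = sym≈ ; trans = trans≈ }
  }

-- A view, so that proofs about η-ext can repeat its case split by a single with.
data η-View : Can → Sub → Set where
  var-shift : ∀ k g r → η-View (atm (var k g)) (shift r)
  other     : ∀ {M u} → η-View M u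

η-view : ∀ M u → η-View M u
η-view (atm (var k g)) (shift r) = var-shift k g r
η-view M u = other

η-ext : Can → Flag → Sub → Sub
η-ext M f u with η-view M u
... | other = ext M f u
... | var-shift k g r with r ≟ suc k ×-dec g ≟ᶠ f
...   | yes (refl , refl) = shift k
...   | no _ = ext M f u

η-ext-redex : ∀ k f → η-ext (atm (var k f)) f (shift (suc k)) ≡ shift k
η-ext-redex k f with suc k ≟ suc k ×-dec f ≟ᶠ f
... | yes (refl , refl) = refl
... | no ¬redex = contradiction (refl , refl) ¬redex

mutual
  nfᶜ : Can → Can
  nfᶜ (atm R) = atm (nfᴿ R)
  nfᶜ (pair M N) = pair (nfᶜ M) (nfᶜ N)
  nfᶜ (llam M) = llam (nfᶜ M)
  nfᶜ (alam M) = alam (nfᶜ M)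
  nfᶜ (ilam M) = ilam (nfᶜ M)

  nfᴿ : Atm → Atm
  nfᴿ (var j g) = var j g
  nfᴿ (mvar X u) = mvar X (nfˢ u)
  nfᴿ (fst R) = fst (nfᴿ R)
  nfᴿ (snd R) = snd (nfᴿ R)
  nfᴿ (lapp R M) = lapp (nfᴿ R) (nfᶜ M)
  nfᴿ (aapp R M) = aapp (nfᴿ R) (nfᶜ M)
  nfᴿ (iapp R M) = iapp (nfᴿ R) (nfᶜ M)

  nfˢ : Sub → Sub
  nfˢ (shift n) = shift n
  nfˢ (ext M f u) = η-ext (nfᶜ M) f (nfˢ u)

mutual
  nfᶜ-cong : ∀ {M M'} → M ≈ M' → nfᶜ M ≡ nfᶜ M'
  nfᶜ-cong refl≈ = refl
  nfᶜ-cong (sym≈ p) = sym (nfᶜ-cong p)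
  nfᶜ-cong (trans≈ p q) = trans (nfᶜ-cong p) (nfᶜ-cong q)
  nfᶜ-cong (atm≈ p) = cong atm (nfᴿ-cong p)
  nfᶜ-cong (pair≈ p q) = cong₂ pair (nfᶜ-cong p) (nfᶜ-cong q)
  nfᶜ-cong (llam≈ p) = cong llam (nfᶜ-cong p)
  nfᶜ-cong (alam≈ p) = cong alam (nfᶜ-cong p)
  nfᶜ-cong (ilam≈ p) = cong ilam (nfᶜ-cong p)

  nfᴿ-cong : ∀ {R R'} → R ≈ᴿ R' → nfᴿ R ≡ nfᴿ R'
  nfᴿ-cong reflᴿ = refl
  nfᴿ-cong (symᴿ p) = sym (nfᴿ-cong p)
  nfᴿ-cong (transᴿ p q) = trans (nfᴿ-cong p) (nfᴿ-cong q)
  nfᴿ-cong (mvar≈ p) = cong (mvar _) (nfˢ-cong p)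
  nfᴿ-cong (fst≈ p) = cong fst (nfᴿ-cong p)
  nfᴿ-cong (snd≈ p) = cong snd (nfᴿ-cong p)
  nfᴿ-cong (lapp≈ p q) = cong₂ lapp (nfᴿ-cong p) (nfᶜ-cong q)
  nfᴿ-cong (aapp≈ p q) = cong₂ aapp (nfᴿ-cong p) (nfᶜ-cong q)
  nfᴿ-cong (iapp≈ p q) = cong₂ iapp (nfᴿ-cong p) (nfᶜ-cong q)

  nfˢ-cong : ∀ {s s'} → s ≈ˢ s' → nfˢ s ≡ nfˢ s'
  nfˢ-cong reflˢ = refl
  nfˢ-cong (symˢ p) = sym (nfˢ-cong p)
  nfˢ-cong (transˢ p q) = trans (nfˢ-cong p) (nfˢ-cong q)
  nfˢ-cong (ext≈ {f = f} p q) = cong₂ (λ M u → η-ext M f u) (nfᶜ-cong p) (nfˢ-cong q)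
  nfˢ-cong (η-shift {n} {f}) = sym (η-ext-redex n f)

drop-suc : ∀ {A : Set} j (P : List A) → drop (suc j) P ≡ drop 1 (drop j P)
drop-suc zero P = refl
drop-suc (suc j) [] = refl
drop-suc (suc j) (x ∷ P) = drop-suc j P

drop-suc-∷ : ∀ {A : Set} j (P : List A) {x Q} → drop j P ≡ x ∷ Q → drop (suc j) P ≡ Q
drop-suc-∷ j P e = trans (drop-suc j P) (cong (drop 1) e)

drop-[]-+ : ∀ {A : Set} i j (P : List A) → drop j P ≡ [] → drop (i + j) P ≡ []
drop-[]-+ zero j P e = e
drop-[]-+ (suc i) j P e = trans (drop-suc (i + j) P) (cong (drop 1) (drop-[]-+ i j P e))

lcId : List (Flag × Flag) → ℕ → Sub
lcId [] k = shift k
lcId ((f , f') ∷ P) k = ext (atm (var k f)) f' (lcId P (suc k))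

-- The pairs need not be Allowed: injectivity holds for any flag pairs.
lcId-from : ∀ {k s} → LCFrom k s → ∃ λ P → s ≡ lcId P k
lcId-from lc-done = [] , refl
lcId-from (lc-step _ lc) with lcId-from lc
... | P , refl = _ ∷ P , refl

lcId-∘-shift1 : ∀ P {k u} → lcId P k ∘ shift 1 ⇓ u → u ≡ lcId P (suc k)
lcId-∘-shift1 [] c-id = refl
lcId-∘-shift1 [] (c-shsh {m}) = cong (λ n → shift (suc n)) (+-comm m 1)
lcId-∘-shift1 ((f , f') ∷ P) {k} (c-ext (s-atm (s-var v-shift)) c) =
  cong₂ (λ n u → ext (atm (var n f)) f' u) (+-comm k 1) (lcId-∘-shift1 P c)

Fits : Maybe (Flag × Flag) → Flag → Set
Fits nothing g = ⊤
Fits (just (f , _)) g = g ≡ f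

retag : Maybe (Flag × Flag) → Flag → Flag
retag nothing g = g
retag (just (_ , f')) _ = f'

mutual
  invᶜ : List (Flag × Flag) → Can → Can
  invᶜ P (atm R) = atm (invᴿ P R)
  invᶜ P (pair M N) = pair (invᶜ P M) (invᶜ P N)
  invᶜ P (llam M) = llam (invᶜ ((L , L) ∷ P) M)
  invᶜ P (alam M) = alam (invᶜ ((A , A) ∷ P) M)
  invᶜ P (ilam M) = ilam (invᶜ ((I , I) ∷ P) M)

  invᴿ : List (Flag × Flag) → Atm → Atm
  invᴿ P (var j g) = var j (retag (head (drop j P)) g)
  invᴿ P (mvar X u) = mvar X (invˢ P u)
  invᴿ P (fst R) = fst (invᴿ P R)
  invᴿ P (snd R) = snd (invᴿ P R)
  invᴿ P (lapp R M) = lapp (invᴿ P R) (invᶜ P M)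
  invᴿ P (aapp R M) = aapp (invᴿ P R) (invᶜ P M)
  invᴿ P (iapp R M) = iapp (invᴿ P R) (invᶜ P M)

  invˢ : List (Flag × Flag) → Sub → Sub
  invˢ P (shift r) = lcId (map swap (drop r P)) r
  invˢ P (ext M f u) = ext (invᶜ P M) f (invˢ P u)

-- ≈ does not preserve this predicate, which is why invᶜ P is applied to η-contracted forms.
mutual
  InImageᶜ : List (Flag × Flag) → Can → Set
  InImageᶜ P (atm R) = InImageᴿ P R
  InImageᶜ P (pair M N) = InImageᶜ P M × InImageᶜ P N
  InImageᶜ P (llam M) = InImageᶜ ((L , L) ∷ P) M
  InImageᶜ P (alam M) = InImageᶜ ((A , A) ∷ P) M
  InImageᶜ P (ilam M) = InImageᶜ ((I , I) ∷ P) M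

  InImageᴿ : List (Flag × Flag) → Atm → Set
  InImageᴿ P (var j g) = Fits (head (drop j P)) g
  InImageᴿ P (mvar X u) = InImageˢ P u
  InImageᴿ P (fst R) = InImageᴿ P R
  InImageᴿ P (snd R) = InImageᴿ P R
  InImageᴿ P (lapp R M) = InImageᴿ P R × InImageᶜ P M
  InImageᴿ P (aapp R M) = InImageᴿ P R × InImageᶜ P M
  InImageᴿ P (iapp R M) = InImageᴿ P R × InImageᶜ P M

  InImageˢ : List (Flag × Flag) → Sub → Set
  InImageˢ P (shift r) = ⊤
  InImageˢ P (ext M f u) = InImageᶜ P M × InImageˢ P u

invˢ-η : ∀ P k g → InImageᴿ P (var k g) →
         invˢ P (shift k) ≈ˢ ext (atm (invᴿ P (var k g))) g (invˢ P (shift (suc k)))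
invˢ-η P k g fits with drop k P in e
... | [] rewrite drop-[]-+ 1 k P e = η-shift
... | (f , f') ∷ Q rewrite fits | drop-suc-∷ k P e = reflˢ

η-ext-inv : ∀ P M f u → InImageᶜ P M → InImageˢ P u →
            InImageˢ P (η-ext M f u) × invˢ P (η-ext M f u) ≈ˢ invˢ P (ext M f u)
η-ext-inv P M f u fitsM fitsu with η-view M u
... | other = (fitsM , fitsu) , reflˢ
... | var-shift k g r with r ≟ suc k ×-dec g ≟ᶠ f
...   | yes (refl , refl) = tt , invˢ-η P k g fitsM
...   | no _ = (fitsM , fitsu) , reflˢ

mutual
  inv-nfᶜ : ∀ P M → InImageᶜ P M → InImageᶜ P (nfᶜ M) × invᶜ P (nfᶜ M) ≈ invᶜ P M
  inv-nfᶜ P (atm R) fits = map₂ atm≈ (inv-nfᴿ P R fits)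
  inv-nfᶜ P (pair M N) (fitsM , fitsN) = zip′ _,_ pair≈ (inv-nfᶜ P M fitsM) (inv-nfᶜ P N fitsN)
  inv-nfᶜ P (llam M) fits = map₂ llam≈ (inv-nfᶜ _ M fits)
  inv-nfᶜ P (alam M) fits = map₂ alam≈ (inv-nfᶜ _ M fits)
  inv-nfᶜ P (ilam M) fits = map₂ ilam≈ (inv-nfᶜ _ M fits)

  inv-nfᴿ : ∀ P R → InImageᴿ P R → InImageᴿ P (nfᴿ R) × invᴿ P (nfᴿ R) ≈ᴿ invᴿ P R
  inv-nfᴿ P (var j g) fits = fits , reflᴿ
  inv-nfᴿ P (mvar X u) fits = map₂ mvar≈ (inv-nfˢ P u fits)
  inv-nfᴿ P (fst R) fits = map₂ fst≈ (inv-nfᴿ P R fits)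
  inv-nfᴿ P (snd R) fits = map₂ snd≈ (inv-nfᴿ P R fits)
  inv-nfᴿ P (lapp R M) (fitsR , fitsM) = zip′ _,_ lapp≈ (inv-nfᴿ P R fitsR) (inv-nfᶜ P M fitsM)
  inv-nfᴿ P (aapp R M) (fitsR , fitsM) = zip′ _,_ aapp≈ (inv-nfᴿ P R fitsR) (inv-nfᶜ P M fitsM)
  inv-nfᴿ P (iapp R M) (fitsR , fitsM) = zip′ _,_ iapp≈ (inv-nfᴿ P R fitsR) (inv-nfᶜ P M fitsM)

  inv-nfˢ : ∀ P u → InImageˢ P u → InImageˢ P (nfˢ u) × invˢ P (nfˢ u) ≈ˢ invˢ P u
  inv-nfˢ P (shift n) tt = tt , reflˢ
  inv-nfˢ P (ext M f u) (fitsM , fitsu) =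
    let fitsM' , M'≈ = inv-nfᶜ P M fitsM
        fitsu' , u'≈ = inv-nfˢ P u fitsu
        fits , η≈ = η-ext-inv P (nfᶜ M) f (nfˢ u) fitsM' fitsu'
    in fits , transˢ η≈ (ext≈ M'≈ u'≈)

lookup-lcId : ∀ P Q {k i f N} → drop k P ≡ Q → var i f ⟨ lcId Q k ⟩ᵛ⇓ N →
  ∃ λ g → N ≡ atm (var (i + k) g) × InImageᴿ P (var (i + k) g)
        × invᴿ P (var (i + k) g) ≡ var (i + k) f
lookup-lcId P [] {k} {i} {f} e v-shift rewrite drop-[]-+ i k P e = f , refl , tt , refl
lookup-lcId P ((g , f) ∷ Q) e v-here rewrite e = g , refl , refl , refl
lookup-lcId P (_ ∷ Q) {k} e (v-there {k = i} v) with lookup-lcId P Q (drop-suc-∷ k P e) v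
... | g , N≡ , fits , inv≡ rewrite sym (+-suc i k) = g , N≡ , fits , inv≡

lcId-inverse : ∀ P Q {k} → drop k P ≡ Q → InImageˢ P (lcId Q k) × invˢ P (lcId Q k) ≈ˢ shift k
lcId-inverse P [] e rewrite e = tt , reflˢ
lcId-inverse P ((f , f') ∷ Q) {k} e with lcId-inverse P Q {suc k} (drop-suc-∷ k P e)
... | fits , inv≈ rewrite e = (refl , fits) , transˢ (ext≈ refl≈ inv≈) (symˢ η-shift)

shift-∘-lcId : ∀ P Q {k m u} → drop k P ≡ Q → shift m ∘ lcId Q k ⇓ u →
               InImageˢ P u × invˢ P u ≈ˢ shift (m + k)
shift-∘-lcId P [] e c-id = lcId-inverse P [] e
shift-∘-lcId P (x ∷ Q) e c-id = lcId-inverse P (x ∷ Q) e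
shift-∘-lcId P [] {k} e (c-shsh {m}) rewrite drop-[]-+ (suc m) k P e = tt , reflˢ
shift-∘-lcId P (_ ∷ Q) {k} e (c-shext {m} c) with shift-∘-lcId P Q (drop-suc-∷ k P e) c
... | fits , inv≈ rewrite sym (+-suc m k) = fits , inv≈

under-binder : ∀ P {f u M N} → lcId P 0 ∘ shift 1 ⇓ u →
               M [ ext (atm (var 0 f)) f u ]⇓ N → M [ lcId ((f , f) ∷ P) 0 ]⇓ N
under-binder P c d with lcId-∘-shift1 P c
... | refl = d

mutual
  inv-subᴿ : ∀ P {R N} → R [ lcId P 0 ]ᴿ⇓ N →
             ∃ λ R' → N ≡ atm R' × InImageᴿ P R' × invᴿ P R' ≈ᴿ R
  inv-subᴿ P (s-var {i} {f} v) with lookup-lcId P P refl v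
  ... | g , N≡ , fits , inv≡ =
    var (i + 0) g , N≡ , fits , ≈ᴿ-reflexive (trans inv≡ (cong (λ n → var n f) (+-identityʳ i)))
  inv-subᴿ P (s-mvar c) with inv-subˢ P c
  ... | fits , u≈ = _ , refl , fits , mvar≈ u≈
  inv-subᴿ P (s-fst d) with inv-subᴿ P d
  ... | _ , refl , fits , R≈ = _ , refl , fits , fst≈ R≈
  inv-subᴿ P (s-fstβ d) with inv-subᴿ P d
  ... | _ , () , _
  inv-subᴿ P (s-snd d) with inv-subᴿ P d
  ... | _ , refl , fits , R≈ = _ , refl , fits , snd≈ R≈
  inv-subᴿ P (s-sndβ d) with inv-subᴿ P d
  ... | _ , () , _
  inv-subᴿ P (s-lapp d e) with inv-subᴿ P d | inv-subᶜ P e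
  ... | _ , refl , fitsR , R≈ | fitsM , M≈ = _ , refl , (fitsR , fitsM) , lapp≈ R≈ M≈
  inv-subᴿ P (s-lappβ d _ _) with inv-subᴿ P d
  ... | _ , () , _
  inv-subᴿ P (s-aapp d e) with inv-subᴿ P d | inv-subᶜ P e
  ... | _ , refl , fitsR , R≈ | fitsM , M≈ = _ , refl , (fitsR , fitsM) , aapp≈ R≈ M≈
  inv-subᴿ P (s-aappβ d _ _) with inv-subᴿ P d
  ... | _ , () , _
  inv-subᴿ P (s-iapp d e) with inv-subᴿ P d | inv-subᶜ P e
  ... | _ , refl , fitsR , R≈ | fitsM , M≈ = _ , refl , (fitsR , fitsM) , iapp≈ R≈ M≈
  inv-subᴿ P (s-iappβ d _ _) with inv-subᴿ P d
  ... | _ , () , _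

  inv-subᶜ : ∀ P {M N} → M [ lcId P 0 ]⇓ N → InImageᶜ P N × invᶜ P N ≈ M
  inv-subᶜ P (s-atm d) with inv-subᴿ P d
  ... | _ , refl , fits , R≈ = fits , atm≈ R≈
  inv-subᶜ P (s-pair d e) = zip′ _,_ pair≈ (inv-subᶜ P d) (inv-subᶜ P e)
  inv-subᶜ P (s-llam c d) = map₂ llam≈ (inv-subᶜ ((L , L) ∷ P) (under-binder P c d))
  inv-subᶜ P (s-alam c d) = map₂ alam≈ (inv-subᶜ ((A , A) ∷ P) (under-binder P c d))
  inv-subᶜ P (s-ilam c d) = map₂ ilam≈ (inv-subᶜ ((I , I) ∷ P) (under-binder P c d))

  inv-subˢ : ∀ P {t u} → t ∘ lcId P 0 ⇓ u → InImageˢ P u × invˢ P u ≈ˢ t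
  inv-subˢ P {ext M f t} (c-ext d c) = zip′ _,_ ext≈ (inv-subᶜ P d) (inv-subˢ P c)
  inv-subˢ P {shift m} {u} c with shift-∘-lcId P P refl c
  ... | fits , u≈ = fits , subst (λ n → invˢ P u ≈ˢ shift n) (+-identityʳ m) u≈

inv-nf-sub : ∀ P {M N} → M [ lcId P 0 ]⇓ N → invᶜ P (nfᶜ N) ≈ M
inv-nf-sub P {N = N} d with inv-subᶜ P d
... | fits , N≈M = trans≈ (proj₂ (inv-nfᶜ P N fits)) N≈M

theorem7 : ∀ (s : Sub) → LinChangingId s →
    ∀ (M M' N N' : Can) → M [ s ]⇓ N → M' [ s ]⇓ N' → N ≈ N' → M ≈ M'
theorem7 s lc M M' N N' M[s]⇓N M'[s]⇓N' N≈N' with lcId-from lc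
... | P , refl = begin
  M                ≈⟨ inv-nf-sub P M[s]⇓N ⟨
  invᶜ P (nfᶜ N)   ≡⟨ cong (invᶜ P) (nfᶜ-cong N≈N') ⟩
  invᶜ P (nfᶜ N')  ≈⟨ inv-nf-sub P M'[s]⇓N' ⟩
  M'               ∎
  where open SetoidReasoning ≈-setoid
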